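{- Suppose $\models \{P\}\,W(t,B)\,\{Q\}$. Then there exists a summary $R$ (correct w.r.t. $P$ and $Q$) for $W(t,B)$ if and only if there exists a safe invariant $I$ for $W(t,B)$ w.r.t. $P$.
   Context: States form a set $S$; commands are relations $C\subseteq S\times\hat S$ with $\hat S = S \uplus \{\mathsf{err}\} \uplus \{\mathrm{brk}(s)\mid s\in S\}$ ($\mathsf{err}$: runtime error outcome; $\mathrm{brk}(s)$: early loop exit via break in state $s$). $\models \{P\}\,C\,\{Q\}$ iff $\forall s,\hat s'.\ P(s)\land C(s,\hat s')\implies Q(\hat s')$ with $P,Q\subseteq S$. $W(t,B)$ is the least relation with: $\lnot t(s)\implies W(t,B)(s,s)$; $t(s)\land B(s,\mathsf{err})\implies W(t,B)(s,\mathsf{err})$; $t(s)\land B(s,\mathrm{brk}(s'))\implies W(t,B)(s,s')$; $t(s)\land B(s,s')\land W(t,B)(s',\hat s'')\implies W(t,B)(s,\hat s'')$. Invariant $I\subseteq S$ w.r.t. $P$: $P(s_0)\implies I(s_0)$, $I(s)\land t(s)\land B(s,s')\implies I(s')$; safe: also $I(s)\land t(s)\land B(s,\mathsf{err})\implies\mathit{false}$. Correct invariant: safe and also $I(s)\land t(s)\land B(s,\mathrm{brk}(s_n))\implies Q(s_n)$ and $I(s_n)\land\lnot t(s_n)\implies Q(s_n)$. Summary $R\subseteq S\times S$: $\lnot t(s_n)\implies R(s_n,s_n)$, $t(s)\land B(s,\mathrm{brk}(s_n))\implies R(s,s_n)$, $t(s)\land B(s,s')\land R(s',s_n)\implies R(s,s_n)$;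 correct w.r.t. $P,Q$: also $P(s_0)\land R(s_0,s_n)\implies Q(s_n)$. -}

module Defs where

open import Data.Empty using (⊥)
open import Relation.Nullary using (¬_)

data Ŝ (S : Set) : Set where
  ok  : S → Ŝ S
  err : Ŝ S
  brk : S → Ŝ S

Cmd : Set → Set₁
Cmd S = S → Ŝ S → Set

lift : {S : Set} → (S → Set) → Ŝ S → Set
lift Q (ok s)  = Q s
lift Q err     = ⊥
lift Q (brk s) = ⊥

⊨⟨_⟩_⟨_⟩ : {S : Set} → (S → Set) → Cmd S → (S → Set) → Set
⊨⟨ P ⟩ C ⟨ Q ⟩ = ∀ s ŝ′ → P s → C s ŝ′ → lift Q ŝ′

data W {S : Set} (t : S → Set) (B : Cmd S) : Cmd S where
  w-exit : ∀ {s} → ¬ t s → W t B s (ok s)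
  w-err  : ∀ {s} → t s → B s err → W t B s err
  w-brk  : ∀ {s s′} → t s → B s (brk s′) → W t B s (ok s′)
  w-step : ∀ {s s′ ŝ″} → t s → B s (ok s′) → W t B s′ ŝ″ → W t B s ŝ″

record Invariant {S : Set} (t : S → Set) (B : Cmd S) (P I : S → Set) : Set where
  field
    init : ∀ s₀ → P s₀ → I s₀
    pres : ∀ s s′ → I s → t s → B s (ok s′) → I s′

record SafeInvariant {S : Set} (t : S → Set) (B : Cmd S) (P I : S → Set) : Set where
  field
    invariant : Invariant t B P I
    safe      : ∀ s → I s → t s → B s err → ⊥

record Summary {S : Set} (t : S → Set) (B : Cmd S) (R : S → S → Set) : Set where
  field
    exit : ∀ sₙ → ¬ t sₙ → R sₙ sₙ
    brk′ : ∀ s sₙ → t s → B s (brk sₙ) → R s sₙ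
    step : ∀ s s′ sₙ → t s → B s (ok s′) → R s′ sₙ → R s sₙ

record CorrectSummary {S : Set} (t : S → Set) (B : Cmd S) (P Q : S → Set) (R : S → S → Set) : Set where
  field
    summary : Summary t B R
    correct : ∀ s₀ sₙ → P s₀ → R s₀ sₙ → Q sₙ

-- Under the hypothesis both sides hold outright, so the equivalence is between two
-- true statements. The loop's own normal-exit relation  s ↦ W t B s (ok sₙ)  is a
-- summary, by the exit, break and step rules of W, and it is correct because the
-- triple is valid. Dually, the weakest liberal precondition of the loop is an
-- invariant: it contains P by validity, it is preserved by a body step because that
-- step extends to a run of the loop, and it is safe because an erring body step is
-- itself an erring run of the loop, whose outcome err satisfies no postcondition.
module Submission where

open import Defs
open import Data.Product using (Σ; _,_)
open import Function.Base using (const)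
open import Function.Bundles using (_⇔_; mk⇔)

wlp : {S : Set} → Cmd S → (S → Set) → S → Set
wlp C Q s = ∀ ŝ → C s ŝ → lift Q ŝ

module _ {S : Set} (t : S → Set) (B : Cmd S) where

  W-terminates-in : S → S → Set
  W-terminates-in s sₙ = W t B s (ok sₙ)

  W-terminates-in-summary : Summary t B W-terminates-in
  W-terminates-in-summary = record
    { exit = λ _ ¬ts → w-exit ¬ts
    ; brk′ = λ _ _ ts b → w-brk ts b
    ; step = λ _ _ _ ts b w → w-step ts b w
    }

  module _ {P Q : S → Set} (valid : ⊨⟨ P ⟩ W t B ⟨ Q ⟩) where

    W-terminates-in-correctSummary : CorrectSummary t B P Q W-terminates-in
    W-terminates-in-correctSummary = record
      { summary = W-terminates-in-summary
      ; correct = λ s₀ sₙ p w → valid s₀ (ok sₙ) p w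
      }

    wlp-W-safeInvariant : SafeInvariant t B P (wlp (W t B) Q)
    wlp-W-safeInvariant = record
      { invariant = record
        { init = λ s₀ p ŝ w → valid s₀ ŝ p w
        ; pres = λ _ _ i ts b ŝ w → i ŝ (w-step ts b w)
        }
      ; safe = λ _ i ts b → i err (w-err ts b)
      }

corollary1 : {S : Set} (t : S → Set) (B : Cmd S) (P Q : S → Set) →
    ⊨⟨ P ⟩ W t B ⟨ Q ⟩ →
    (Σ (S → S → Set) (λ R → CorrectSummary t B P Q R))
    ⇔ (Σ (S → Set) (λ I → SafeInvariant t B P I))
corollary1 t B P Q valid = mk⇔
  (const (wlp (W t B) Q , wlp-W-safeInvariant t B valid))
  (const (W-terminates-in t B , W-terminates-in-correctSummary t B valid))
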